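{- The sum of groves of planar trees is associative: $(x+y)+z=x+(y+z)$ for all groves $x,y,z$, and $|$ is a neutral element: $|+x=x=x+|$.
   Context: A planar tree of degree $n\ge0$ is a planar rooted tree (up to planar isotopy) with $n+1$ leaves in which every internal vertex has at least two inputs; $T_n$ is the set of these trees, $T_0=\{|\}$ ($|$ is also written $0$). For trees $x^{(0)},\dots,x^{(k)}$ ($k\ge1$), the grafting $x^{(0)}\vee\cdots\vee x^{(k)}$ joins their roots (in this order) to a new vertex carrying a new root; every tree $x$ of positive degree decomposes uniquely as $x=x^{(0)}\vee\cdots\vee x^{(k)}$ with $k\ge1$. Grafting involving groves is done elementwise. A grove is a nonempty subset of some $T_n$; operations on groves are extended from trees by distributivity (union over all pairs, counted with multiplicity). The sum is defined recursively: $|+x=x+|=x$, and for $x=x^{(0)}\vee\cdots\vee x^{(k)}$, $y=y^{(0)}\vee\cdots\vee y^{(\ell)}$ of positive degree, $x+y:=(x\dashv y)\cup(x\perp y)\cup(x\vdash y)$ where $x\dashv y:=x^{(0)}\vee\cdots\vee x^{(k-1)}\vee(x^{(k)}+y)$, $x\perp y:=x^{(0)}\vee\cdots\vee x^{(k-1)}\vee(x^{(k)}+y^{(0)})\vee y^{(1)}\vee\cdots\vee y^{(\ell)}$, $x\vdash y:=(x+y^{(0)})\vee y^{(1)}\vee\cdots\vee y^{(\ell)}$. -}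

module Defs where

open import Data.Nat using (ℕ; zero; suc; _+_; _∸_)
open import Data.List using (List; []; _∷_; [_]; _++_; map; concatMap)
open import Data.List.Relation.Unary.All using (All)
open import Data.List.Relation.Unary.Unique.Propositional using (Unique)
open import Data.Product using (Σ; _×_)
open import Relation.Binary.PropositionalEquality using (_≡_; _≢_)

-- A tree of positive degree x = x⁽⁰⁾ ∨ x⁽¹⁾ ∨ ⋯ ∨ x⁽ᵏ⁾ (k ≥ 1)
-- is represented as  node x⁽⁰⁾ (x⁽¹⁾ , … , x⁽ᵏ⁾)  where the second argument is a
-- NONEMPTY list of children; so every internal vertex has at least two inputs.
mutual
  data Tree : Set where
    leaf : Tree
    node : Tree → Children → Tree

  data Children : Set where
    one : Tree → Children
    _∷ᶜ_ : Tree → Children → Children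

infixr 5 _∷ᶜ_

mutual
  leaves : Tree → ℕ
  leaves leaf = 1
  leaves (node t cs) = leaves t + leavesᶜ cs

  leavesᶜ : Children → ℕ
  leavesᶜ (one t) = leaves t
  leavesᶜ (t ∷ᶜ cs) = leaves t + leavesᶜ cs

degree : Tree → ℕ
degree t = leaves t ∸ 1

mutual
  infixl 6 _⊕_
  _⊕_ : Tree → Tree → List Tree
  leaf ⊕ y = [ y ]
  node x0 xs ⊕ leaf = [ node x0 xs ]
  node x0 xs ⊕ node y0 ys =
       map (node x0) (lastPlus xs (node y0 ys))
    ++ map (node x0) (lastPlusApp xs y0 ys)
    ++ map (λ t → node t ys) (node x0 xs ⊕ y0)

  lastPlus : Children → Tree → List Children
  lastPlus (one c) y = map one (c ⊕ y)
  lastPlus (c ∷ᶜ cs) y = map (c ∷ᶜ_) (lastPlus cs y)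

  lastPlusApp : Children → Tree → Children → List Children
  lastPlusApp (one c) y0 ys = map (_∷ᶜ ys) (c ⊕ y0)
  lastPlusApp (c ∷ᶜ cs) y0 ys = map (c ∷ᶜ_) (lastPlusApp cs y0 ys)

-- Groves as finite lists (multisets); sums extended by distributivity,
-- counted with multiplicity.
infixl 6 _+ᴳ_
_+ᴳ_ : List Tree → List Tree → List Tree
X +ᴳ Y = concatMap (λ x → concatMap (λ y → x ⊕ y) Y) X

IsGrove : ℕ → List Tree → Set
IsGrove n X = (X ≢ []) × All (λ t → degree t ≡ n) X × Unique X

-- For trees of positive degree the sum is x + y = (x ⊣ y) ∪ (x ⊥ y) ∪ (x ⊢ y), and the
-- three operations satisfy the seven axioms of a tridendriform algebra; associativity of +
-- then follows formally by regrouping the nine pieces of (x + y) + z.  The axioms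
-- (x ⊣ y) ⊣ z = x ⊣ (y + z), (x ⊣ y) ⊥ z = x ⊥ (y ⊢ z) and (x + y) ⊢ z = x ⊢ (y ⊢ z) are
-- associativity again, at the last child of x and/or the first child of z, so they are
-- proved together with associativity by an induction in which x or z shrinks.  The other
-- four axioms only interchange independent choices made in different subtrees.  Groves
-- inherit associativity by distributivity.
module Submission where

open import Defs
open import Data.Nat using (ℕ)
open import Data.List using (List; []; _∷_; [_]; _++_; map; concatMap)
open import Data.List.Properties
  using (concatMap-cong; concatMap-map; concatMap-++; concatMap-pure; map-concatMap; ++-identityʳ)
open import Data.List.Effectful using (module MonadProperties)
open import Data.List.Relation.Binary.BagAndSetEquality using (>>=-left-distributive; ∼bag⇒↭)
open import Data.List.Relation.Binary.Permutation.Propositional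
  using (_↭_; ↭-refl; ↭-reflexive; ↭-trans; module PermutationReasoning)
open import Data.List.Relation.Binary.Permutation.Propositional.Properties
  using (++⁺; ++⁺ˡ; map⁺; ++-commutativeMonoid)
open import Data.Product using (_×_; _,_)
open import Function using (_∘_)
open import Relation.Binary.PropositionalEquality
  using (_≡_; refl; sym; trans; cong; cong₂)

open MonadProperties using (associative; right-zero)
open PermutationReasoning

private variable
  A A′ B C : Set

concatMap⁺ : {f g : A → List B} → (∀ a → f a ↭ g a) →
             ∀ xs → concatMap f xs ↭ concatMap g xs
concatMap⁺ f↭g []       = ↭-refl
concatMap⁺ f↭g (x ∷ xs) = ++⁺ (f↭g x) (concatMap⁺ f↭g xs)

concatMap-++-distrib : (f g : A → List B) (xs : List A) →
  concatMap (λ a → f a ++ g a) xs ↭ concatMap f xs ++ concatMap g xs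
concatMap-++-distrib f g xs = ∼bag⇒↭ (>>=-left-distributive xs)

concatMap-++³-distrib : (f g h : A → List B) (xs : List A) →
  concatMap (λ a → f a ++ g a ++ h a) xs ↭ concatMap f xs ++ concatMap g xs ++ concatMap h xs
concatMap-++³-distrib f g h xs = begin
  concatMap (λ a → f a ++ g a ++ h a) xs
    ↭⟨ concatMap-++-distrib f (λ a → g a ++ h a) xs ⟩
  concatMap f xs ++ concatMap (λ a → g a ++ h a) xs
    ↭⟨ ++⁺ˡ (concatMap f xs) (concatMap-++-distrib g h xs) ⟩
  concatMap f xs ++ concatMap g xs ++ concatMap h xs ∎

concatMap-++³ : (f : A → List B) (xs ys zs : List A) →
  concatMap f (xs ++ ys ++ zs) ≡ concatMap f xs ++ concatMap f ys ++ concatMap f zs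
concatMap-++³ f xs ys zs =
  trans (concatMap-++ f xs (ys ++ zs)) (cong (concatMap f xs ++_) (concatMap-++ f ys zs))

concatMap-comm : (g : A → B → List C) (xs : List A) (ys : List B) →
  concatMap (λ x → concatMap (g x) ys) xs ↭ concatMap (λ y → concatMap (λ x → g x y) xs) ys
concatMap-comm g []       ys = ↭-reflexive (sym (right-zero ys))
concatMap-comm g (x ∷ xs) ys = begin
  concatMap (g x) ys ++ concatMap (λ x → concatMap (g x) ys) xs
    ↭⟨ ++⁺ˡ (concatMap (g x) ys) (concatMap-comm g xs ys) ⟩
  concatMap (g x) ys ++ concatMap (λ y → concatMap (λ x → g x y) xs) ys
    ↭⟨ concatMap-++-distrib (g x) (λ y → concatMap (λ x → g x y) xs) ys ⟨
  concatMap (λ y → g x y ++ concatMap (λ x → g x y) xs) ys ∎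

map-as-concatMap : (f : A → B) (xs : List A) → map f xs ≡ concatMap (λ x → [ f x ]) xs
map-as-concatMap f xs = trans (sym (concatMap-pure (map f xs))) (concatMap-map [_] f xs)

concatMap-map-comm : (g : A → B → C) (xs : List A) (ys : List B) →
  concatMap (λ x → map (g x) ys) xs ↭ concatMap (λ y → map (λ x → g x y) xs) ys
concatMap-map-comm g xs ys = begin
  concatMap (λ x → map (g x) ys) xs
    ≡⟨ concatMap-cong (λ x → map-as-concatMap (g x) ys) xs ⟩
  concatMap (λ x → concatMap (λ y → [ g x y ]) ys) xs
    ↭⟨ concatMap-comm (λ x y → [ g x y ]) xs ys ⟩
  concatMap (λ y → concatMap (λ x → [ g x y ]) xs) ys
    ≡⟨ concatMap-cong (λ y → map-as-concatMap (λ x → g x y) xs) ys ⟨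
  concatMap (λ y → map (λ x → g x y) xs) ys ∎

map-concatMap⁺ : (f : B → C) (g : A → List B) (h : A′ → List B) (xs : List A) (ys : List A′) →
  concatMap g xs ↭ concatMap h ys → concatMap (map f ∘ g) xs ↭ concatMap (map f ∘ h) ys
map-concatMap⁺ f g h xs ys p = begin
  concatMap (map f ∘ g) xs ≡⟨ map-concatMap f g xs ⟨
  map f (concatMap g xs)   ↭⟨ map⁺ f p ⟩
  map f (concatMap h ys)   ≡⟨ map-concatMap f h ys ⟩
  concatMap (map f ∘ h) ys ∎

module BilinearExtension {A : Set} (_∙_ : A → A → List A) where

  infixl 6 _⋆_
  _⋆_ : List A → List A → List A
  xs ⋆ ys = concatMap (λ x → concatMap (x ∙_) ys) xs

  ⋆-assoc : (∀ x y z → concatMap (_∙ z) (x ∙ y) ↭ concatMap (x ∙_) (y ∙ z)) →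
            ∀ xs ys zs → (xs ⋆ ys) ⋆ zs ↭ xs ⋆ (ys ⋆ zs)
  ⋆-assoc ∙-assoc xs ys zs = begin
    (xs ⋆ ys) ⋆ zs
      ≡⟨ associative xs (λ x → concatMap (x ∙_) ys) (λ t → concatMap (t ∙_) zs) ⟨
    concatMap (λ x → concatMap (λ t → concatMap (t ∙_) zs) (concatMap (x ∙_) ys)) xs
      ↭⟨ concatMap⁺ assoc-at xs ⟩
    xs ⋆ (ys ⋆ zs) ∎
    where
    assoc-at : ∀ x → concatMap (λ t → concatMap (t ∙_) zs) (concatMap (x ∙_) ys)
                      ↭ concatMap (x ∙_) (ys ⋆ zs)
    assoc-at x = begin
      concatMap (λ t → concatMap (t ∙_) zs) (concatMap (x ∙_) ys)
        ≡⟨ associative ys (x ∙_) (λ t → concatMap (t ∙_) zs) ⟨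
      concatMap (λ y → concatMap (λ t → concatMap (t ∙_) zs) (x ∙ y)) ys
        ↭⟨ concatMap⁺ (λ y → concatMap-comm _∙_ (x ∙ y) zs) ys ⟩
      concatMap (λ y → concatMap (λ z → concatMap (_∙ z) (x ∙ y)) zs) ys
        ↭⟨ concatMap⁺ (λ y → concatMap⁺ (∙-assoc x y) zs) ys ⟩
      concatMap (λ y → concatMap (λ z → concatMap (x ∙_) (y ∙ z)) zs) ys
        ≡⟨ concatMap-cong (λ y → associative zs (y ∙_) (x ∙_)) ys ⟩
      concatMap (λ y → concatMap (x ∙_) (concatMap (y ∙_) zs)) ys
        ≡⟨ associative ys (λ y → concatMap (y ∙_) zs) (x ∙_) ⟩
      concatMap (x ∙_) (ys ⋆ zs) ∎

  ⋆-identityˡ : ∀ e → (∀ x → e ∙ x ≡ [ x ]) → ∀ xs → [ e ] ⋆ xs ≡ xs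
  ⋆-identityˡ e e∙x≡x xs =
    trans (++-identityʳ _) (trans (concatMap-cong e∙x≡x xs) (concatMap-pure xs))

  ⋆-identityʳ : ∀ e → (∀ x → x ∙ e ≡ [ x ]) → ∀ xs → xs ⋆ [ e ] ≡ xs
  ⋆-identityʳ e x∙e≡x xs =
    trans (concatMap-cong (λ x → cong (_++ []) (x∙e≡x x)) xs) (concatMap-pure xs)

module Tridendriform {A : Set} (_⊣_ _⊥_ _⊢_ : A → A → List A) where

  open import Algebra.Solver.CommutativeMonoid (++-commutativeMonoid {A = A})
    using (solve; _⊜_) renaming (_⊕_ to _⊞_)

  infixl 6 _∙_
  _∙_ : A → A → List A
  x ∙ y = x ⊣ y ++ x ⊥ y ++ x ⊢ y

  private
    regroup : (a b c d e f g : List A) →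
      (a ++ b ++ c) ++ (d ++ e ++ f) ++ g ↭ a ++ (b ++ e ++ d) ++ (c ++ f ++ g)
    regroup = solve 7 (λ a b c d e f g →
      ((a ⊞ (b ⊞ c)) ⊞ ((d ⊞ (e ⊞ f)) ⊞ g)) ⊜ (a ⊞ ((b ⊞ (e ⊞ d)) ⊞ (c ⊞ (f ⊞ g))))) ↭-refl

  ∙-assoc : ∀ x y z →
    concatMap (_⊣ z) (x ⊣ y) ↭ concatMap (x ⊣_) (y ∙ z) →
    concatMap (_⊥ z) (x ⊣ y) ↭ concatMap (x ⊥_) (y ⊢ z) →
    concatMap (_⊣ z) (x ⊥ y) ↭ concatMap (x ⊥_) (y ⊣ z) →
    concatMap (_⊥ z) (x ⊥ y) ↭ concatMap (x ⊥_) (y ⊥ z) →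
    concatMap (_⊣ z) (x ⊢ y) ↭ concatMap (x ⊢_) (y ⊣ z) →
    concatMap (_⊥ z) (x ⊢ y) ↭ concatMap (x ⊢_) (y ⊥ z) →
    concatMap (_⊢ z) (x ∙ y) ↭ concatMap (x ⊢_) (y ⊢ z) →
    concatMap (_∙ z) (x ∙ y) ↭ concatMap (x ∙_) (y ∙ z)
  ∙-assoc x y z ⊣⊣ ⊣⊥ ⊥⊣ ⊥⊥ ⊢⊣ ⊢⊥ ∙⊢ = begin
    concatMap (_∙ z) (x ∙ y)
      ↭⟨ concatMap-++³-distrib (_⊣ z) (_⊥ z) (_⊢ z) (x ∙ y) ⟩
    concatMap (_⊣ z) (x ∙ y) ++ concatMap (_⊥ z) (x ∙ y) ++ concatMap (_⊢ z) (x ∙ y)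
      ≡⟨ cong₂ _++_ (concatMap-++³ (_⊣ z) (x ⊣ y) (x ⊥ y) (x ⊢ y))
                    (cong (_++ concatMap (_⊢ z) (x ∙ y)) (concatMap-++³ (_⊥ z) (x ⊣ y) (x ⊥ y) (x ⊢ y))) ⟩
    (concatMap (_⊣ z) (x ⊣ y) ++ concatMap (_⊣ z) (x ⊥ y) ++ concatMap (_⊣ z) (x ⊢ y)) ++
    (concatMap (_⊥ z) (x ⊣ y) ++ concatMap (_⊥ z) (x ⊥ y) ++ concatMap (_⊥ z) (x ⊢ y)) ++
    concatMap (_⊢ z) (x ∙ y)
      ↭⟨ ++⁺ (++⁺ ⊣⊣ (++⁺ ⊥⊣ ⊢⊣)) (++⁺ (++⁺ ⊣⊥ (++⁺ ⊥⊥ ⊢⊥)) ∙⊢) ⟩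
    (concatMap (x ⊣_) (y ∙ z) ++ concatMap (x ⊥_) (y ⊣ z) ++ concatMap (x ⊢_) (y ⊣ z)) ++
    (concatMap (x ⊥_) (y ⊢ z) ++ concatMap (x ⊥_) (y ⊥ z) ++ concatMap (x ⊢_) (y ⊥ z)) ++
    concatMap (x ⊢_) (y ⊢ z)
      ↭⟨ regroup (concatMap (x ⊣_) (y ∙ z)) (concatMap (x ⊥_) (y ⊣ z)) (concatMap (x ⊢_) (y ⊣ z))
                 (concatMap (x ⊥_) (y ⊢ z)) (concatMap (x ⊥_) (y ⊥ z)) (concatMap (x ⊢_) (y ⊥ z))
                 (concatMap (x ⊢_) (y ⊢ z)) ⟩
    concatMap (x ⊣_) (y ∙ z) ++
    (concatMap (x ⊥_) (y ⊣ z) ++ concatMap (x ⊥_) (y ⊥ z) ++ concatMap (x ⊥_) (y ⊢ z)) ++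
    (concatMap (x ⊢_) (y ⊣ z) ++ concatMap (x ⊢_) (y ⊥ z) ++ concatMap (x ⊢_) (y ⊢ z))
      ≡⟨ cong₂ (λ u v → concatMap (x ⊣_) (y ∙ z) ++ u ++ v)
               (concatMap-++³ (x ⊥_) (y ⊣ z) (y ⊥ z) (y ⊢ z))
               (concatMap-++³ (x ⊢_) (y ⊣ z) (y ⊥ z) (y ⊢ z)) ⟨
    concatMap (x ⊣_) (y ∙ z) ++ concatMap (x ⊥_) (y ∙ z) ++ concatMap (x ⊢_) (y ∙ z)
      ↭⟨ concatMap-++³-distrib (x ⊣_) (x ⊥_) (x ⊢_) (y ∙ z) ⟨
    concatMap (x ∙_) (y ∙ z) ∎

concatMap-[] : {f : A → List B} → (∀ a → f a ≡ []) → ∀ xs → concatMap f xs ≡ []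
concatMap-[] f≡[] xs = trans (concatMap-cong f≡[] xs) (right-zero xs)

-- The paper's x ⊣ y, x ⊥ y, x ⊢ y, taken empty where the defining formula would
-- decompose a leaf; the tridendriform sum x ∙ y then agrees with x ⊕ y unless x = y = leaf.
_⊣_ _⊥_ _⊢_ : Tree → Tree → List Tree
leaf       ⊣ y = []
node x0 xs ⊣ y = map (node x0) (lastPlus xs y)

x          ⊥ leaf       = []
leaf       ⊥ node _ _   = []
node x0 xs ⊥ node y0 ys = map (node x0) (lastPlusApp xs y0 ys)

x ⊢ leaf       = []
x ⊢ node y0 ys = map (λ t → node t ys) (x ⊕ y0)

open Tridendriform _⊣_ _⊥_ _⊢_ using (_∙_; ∙-assoc)

⊥-zeroˡ : ∀ y → leaf ⊥ y ≡ []
⊥-zeroˡ leaf         = refl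
⊥-zeroˡ (node _ _) = refl

⊕-identityʳ : ∀ x → x ⊕ leaf ≡ [ x ]
⊕-identityʳ leaf       = refl
⊕-identityʳ (node _ _) = refl

lastPlus-identityʳ : ∀ xs → lastPlus xs leaf ≡ [ xs ]
lastPlus-identityʳ (one c)   = cong (map one) (⊕-identityʳ c)
lastPlus-identityʳ (c ∷ᶜ cs) = cong (map (c ∷ᶜ_)) (lastPlus-identityʳ cs)

⊕-splitˡ : ∀ x0 xs y → node x0 xs ⊕ y ≡ node x0 xs ∙ y
⊕-splitˡ x0 xs leaf       = cong (λ css → map (node x0) css ++ []) (sym (lastPlus-identityʳ xs))
⊕-splitˡ x0 xs (node _ _) = refl

⊕-splitʳ : ∀ x y0 ys → x ⊕ node y0 ys ≡ x ∙ node y0 ys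
⊕-splitʳ leaf       y0 ys = refl
⊕-splitʳ (node _ _) y0 ys = refl

ActsOnLastChild : (Children → List Children) → Set
ActsOnLastChild F = ∀ c cs → F (c ∷ᶜ cs) ≡ map (c ∷ᶜ_) (F cs)

lastPlusApp-interchange : ∀ F → ActsOnLastChild F → ∀ xs y0 ys →
  concatMap F (lastPlusApp xs y0 ys) ↭ concatMap (lastPlusApp xs y0) (F ys)
lastPlusApp-interchange F F-last (one c) y0 ys = begin
  concatMap F (map (_∷ᶜ ys) (c ⊕ y0))            ≡⟨ concatMap-map F (_∷ᶜ ys) (c ⊕ y0) ⟩
  concatMap (λ t → F (t ∷ᶜ ys)) (c ⊕ y0)         ≡⟨ concatMap-cong (λ t → F-last t ys) (c ⊕ y0) ⟩
  concatMap (λ t → map (t ∷ᶜ_) (F ys)) (c ⊕ y0)  ↭⟨ concatMap-map-comm _∷ᶜ_ (c ⊕ y0) (F ys) ⟩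
  concatMap (λ cs → map (_∷ᶜ cs) (c ⊕ y0)) (F ys) ∎
lastPlusApp-interchange F F-last (c ∷ᶜ xs) y0 ys = begin
  concatMap F (map (c ∷ᶜ_) (lastPlusApp xs y0 ys))     ≡⟨ concatMap-map F (c ∷ᶜ_) (lastPlusApp xs y0 ys) ⟩
  concatMap (λ cs → F (c ∷ᶜ cs)) (lastPlusApp xs y0 ys) ≡⟨ concatMap-cong (F-last c) (lastPlusApp xs y0 ys) ⟩
  concatMap (map (c ∷ᶜ_) ∘ F) (lastPlusApp xs y0 ys)
    ↭⟨ map-concatMap⁺ (c ∷ᶜ_) F (lastPlusApp xs y0) (lastPlusApp xs y0 ys) (F ys)
        (lastPlusApp-interchange F F-last xs y0 ys) ⟩
  concatMap (map (c ∷ᶜ_) ∘ lastPlusApp xs y0) (F ys) ∎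

⊥-⊣ : ∀ x y z → concatMap (_⊣ z) (x ⊥ y) ↭ concatMap (x ⊥_) (y ⊣ z)
⊥-⊣ x leaf z = ↭-refl
⊥-⊣ leaf (node y0 ys) z = ↭-reflexive (sym (concatMap-[] ⊥-zeroˡ (node y0 ys ⊣ z)))
⊥-⊣ (node x0 xs) (node y0 ys) z = begin
  concatMap (_⊣ z) (map (node x0) (lastPlusApp xs y0 ys))
    ≡⟨ concatMap-map (_⊣ z) (node x0) (lastPlusApp xs y0 ys) ⟩
  concatMap (λ cs → map (node x0) (lastPlus cs z)) (lastPlusApp xs y0 ys)
    ↭⟨ map-concatMap⁺ (node x0) (λ cs → lastPlus cs z) (lastPlusApp xs y0)
         (lastPlusApp xs y0 ys) (lastPlus ys z)
         (lastPlusApp-interchange (λ cs → lastPlus cs z) (λ _ _ → refl) xs y0 ys) ⟩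
  concatMap (λ cs → map (node x0) (lastPlusApp xs y0 cs)) (lastPlus ys z)
    ≡⟨ concatMap-map (node x0 xs ⊥_) (node y0) (lastPlus ys z) ⟨
  concatMap (node x0 xs ⊥_) (map (node y0) (lastPlus ys z)) ∎

⊥-⊥ : ∀ x y z → concatMap (_⊥ z) (x ⊥ y) ↭ concatMap (x ⊥_) (y ⊥ z)
⊥-⊥ x y leaf = ↭-reflexive (right-zero (x ⊥ y))
⊥-⊥ x leaf (node _ _) = ↭-refl
⊥-⊥ leaf (node y0 ys) (node z0 zs) = ↭-reflexive (sym (concatMap-[] ⊥-zeroˡ (node y0 ys ⊥ node z0 zs)))
⊥-⊥ (node x0 xs) (node y0 ys) (node z0 zs) = begin
  concatMap (_⊥ node z0 zs) (map (node x0) (lastPlusApp xs y0 ys))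
    ≡⟨ concatMap-map (_⊥ node z0 zs) (node x0) (lastPlusApp xs y0 ys) ⟩
  concatMap (λ cs → map (node x0) (lastPlusApp cs z0 zs)) (lastPlusApp xs y0 ys)
    ↭⟨ map-concatMap⁺ (node x0) (λ cs → lastPlusApp cs z0 zs) (lastPlusApp xs y0)
         (lastPlusApp xs y0 ys) (lastPlusApp ys z0 zs)
         (lastPlusApp-interchange (λ cs → lastPlusApp cs z0 zs) (λ _ _ → refl) xs y0 ys) ⟩
  concatMap (λ cs → map (node x0) (lastPlusApp xs y0 cs)) (lastPlusApp ys z0 zs)
    ≡⟨ concatMap-map (node x0 xs ⊥_) (node y0) (lastPlusApp ys z0 zs) ⟨
  concatMap (node x0 xs ⊥_) (map (node y0) (lastPlusApp ys z0 zs)) ∎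

⊢-⊣ : ∀ x y z → concatMap (_⊣ z) (x ⊢ y) ↭ concatMap (x ⊢_) (y ⊣ z)
⊢-⊣ x leaf z = ↭-refl
⊢-⊣ x (node y0 ys) z = begin
  concatMap (_⊣ z) (map (λ t → node t ys) (x ⊕ y0))
    ≡⟨ concatMap-map (_⊣ z) (λ t → node t ys) (x ⊕ y0) ⟩
  concatMap (λ t → map (node t) (lastPlus ys z)) (x ⊕ y0)
    ↭⟨ concatMap-map-comm node (x ⊕ y0) (lastPlus ys z) ⟩
  concatMap (λ cs → map (λ t → node t cs) (x ⊕ y0)) (lastPlus ys z)
    ≡⟨ concatMap-map (x ⊢_) (node y0) (lastPlus ys z) ⟨
  concatMap (x ⊢_) (map (node y0) (lastPlus ys z)) ∎

⊢-⊥ : ∀ x y z → concatMap (_⊥ z) (x ⊢ y) ↭ concatMap (x ⊢_) (y ⊥ z)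
⊢-⊥ x y leaf = ↭-reflexive (right-zero (x ⊢ y))
⊢-⊥ x leaf (node _ _) = ↭-refl
⊢-⊥ x (node y0 ys) (node z0 zs) = begin
  concatMap (_⊥ node z0 zs) (map (λ t → node t ys) (x ⊕ y0))
    ≡⟨ concatMap-map (_⊥ node z0 zs) (λ t → node t ys) (x ⊕ y0) ⟩
  concatMap (λ t → map (node t) (lastPlusApp ys z0 zs)) (x ⊕ y0)
    ↭⟨ concatMap-map-comm node (x ⊕ y0) (lastPlusApp ys z0 zs) ⟩
  concatMap (λ cs → map (λ t → node t cs) (x ⊕ y0)) (lastPlusApp ys z0 zs)
    ≡⟨ concatMap-map (x ⊢_) (node y0) (lastPlusApp ys z0 zs) ⟨
  concatMap (x ⊢_) (map (node y0) (lastPlusApp ys z0 zs)) ∎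

mutual
  ⊕-assoc : ∀ x y z → concatMap (_⊕ z) (x ⊕ y) ↭ concatMap (x ⊕_) (y ⊕ z)
  ⊕-assoc leaf y z = ↭-reflexive (trans (++-identityʳ (y ⊕ z)) (sym (concatMap-pure (y ⊕ z))))
  ⊕-assoc x y leaf = begin
    concatMap (_⊕ leaf) (x ⊕ y)  ≡⟨ trans (concatMap-cong ⊕-identityʳ (x ⊕ y)) (concatMap-pure (x ⊕ y)) ⟩
    x ⊕ y                        ≡⟨ ++-identityʳ (x ⊕ y) ⟨
    concatMap (x ⊕_) [ y ]       ≡⟨ cong (concatMap (x ⊕_)) (⊕-identityʳ y) ⟨
    concatMap (x ⊕_) (y ⊕ leaf)  ∎
  ⊕-assoc x@(node x0 xs) y z@(node z0 zs) = begin
    concatMap (_⊕ z) (x ⊕ y)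
      ≡⟨ trans (concatMap-cong (λ t → ⊕-splitʳ t z0 zs) (x ⊕ y)) (cong (concatMap (_∙ z)) x⊕y≡x∙y) ⟩
    concatMap (_∙ z) (x ∙ y)
      ↭⟨ ∙-assoc x y z (↭-trans (⊣-⊣ x y z) (↭-reflexive (cong (concatMap (x ⊣_)) y⊕z≡y∙z)))
                       (⊣-⊥ x y z) (⊥-⊣ x y z) (⊥-⊥ x y z) (⊢-⊣ x y z) (⊢-⊥ x y z)
                       (↭-trans (↭-reflexive (cong (concatMap (_⊢ z)) (sym x⊕y≡x∙y))) (⊕-⊢ x y z)) ⟩
    concatMap (x ∙_) (y ∙ z)
      ≡⟨ trans (concatMap-cong (⊕-splitˡ x0 xs) (y ⊕ z)) (cong (concatMap (x ∙_)) y⊕z≡y∙z) ⟨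
    concatMap (x ⊕_) (y ⊕ z) ∎
    where
    x⊕y≡x∙y : x ⊕ y ≡ x ∙ y
    x⊕y≡x∙y = ⊕-splitˡ x0 xs y
    y⊕z≡y∙z : y ⊕ z ≡ y ∙ z
    y⊕z≡y∙z = ⊕-splitʳ y z0 zs

  lastPlus-assoc : ∀ xs y z →
    concatMap (λ cs → lastPlus cs z) (lastPlus xs y) ↭ concatMap (lastPlus xs) (y ⊕ z)
  lastPlus-assoc (one c) y z = begin
    concatMap (λ cs → lastPlus cs z) (map one (c ⊕ y))  ≡⟨ concatMap-map (λ cs → lastPlus cs z) one (c ⊕ y) ⟩
    concatMap (λ t → map one (t ⊕ z)) (c ⊕ y)
      ↭⟨ map-concatMap⁺ one (_⊕ z) (c ⊕_) (c ⊕ y) (y ⊕ z) (⊕-assoc c y z) ⟩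
    concatMap (λ u → map one (c ⊕ u)) (y ⊕ z)           ∎
  lastPlus-assoc (c ∷ᶜ xs) y z = begin
    concatMap (λ cs → lastPlus cs z) (map (c ∷ᶜ_) (lastPlus xs y))
      ≡⟨ concatMap-map (λ cs → lastPlus cs z) (c ∷ᶜ_) (lastPlus xs y) ⟩
    concatMap (λ cs → map (c ∷ᶜ_) (lastPlus cs z)) (lastPlus xs y)
      ↭⟨ map-concatMap⁺ (c ∷ᶜ_) (λ cs → lastPlus cs z) (lastPlus xs) (lastPlus xs y) (y ⊕ z)
           (lastPlus-assoc xs y z) ⟩
    concatMap (λ u → map (c ∷ᶜ_) (lastPlus xs u)) (y ⊕ z) ∎

  lastPlus-lastPlusApp : ∀ xs y z0 zs →
    concatMap (λ cs → lastPlusApp cs z0 zs) (lastPlus xs y) ↭ concatMap (λ t → lastPlusApp xs t zs) (y ⊕ z0)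
  lastPlus-lastPlusApp (one c) y z0 zs = begin
    concatMap (λ cs → lastPlusApp cs z0 zs) (map one (c ⊕ y))
      ≡⟨ concatMap-map (λ cs → lastPlusApp cs z0 zs) one (c ⊕ y) ⟩
    concatMap (λ t → map (_∷ᶜ zs) (t ⊕ z0)) (c ⊕ y)
      ↭⟨ map-concatMap⁺ (_∷ᶜ zs) (_⊕ z0) (c ⊕_) (c ⊕ y) (y ⊕ z0) (⊕-assoc c y z0) ⟩
    concatMap (λ u → map (_∷ᶜ zs) (c ⊕ u)) (y ⊕ z0) ∎
  lastPlus-lastPlusApp (c ∷ᶜ xs) y z0 zs = begin
    concatMap (λ cs → lastPlusApp cs z0 zs) (map (c ∷ᶜ_) (lastPlus xs y))
      ≡⟨ concatMap-map (λ cs → lastPlusApp cs z0 zs) (c ∷ᶜ_) (lastPlus xs y) ⟩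
    concatMap (λ cs → map (c ∷ᶜ_) (lastPlusApp cs z0 zs)) (lastPlus xs y)
      ↭⟨ map-concatMap⁺ (c ∷ᶜ_) (λ cs → lastPlusApp cs z0 zs) (λ t → lastPlusApp xs t zs)
           (lastPlus xs y) (y ⊕ z0) (lastPlus-lastPlusApp xs y z0 zs) ⟩
    concatMap (λ u → map (c ∷ᶜ_) (lastPlusApp xs u zs)) (y ⊕ z0) ∎

  ⊣-⊣ : ∀ x y z → concatMap (_⊣ z) (x ⊣ y) ↭ concatMap (x ⊣_) (y ⊕ z)
  ⊣-⊣ leaf y z = ↭-reflexive (sym (right-zero (y ⊕ z)))
  ⊣-⊣ (node x0 xs) y z = begin
    concatMap (_⊣ z) (map (node x0) (lastPlus xs y))
      ≡⟨ concatMap-map (_⊣ z) (node x0) (lastPlus xs y) ⟩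
    concatMap (λ cs → map (node x0) (lastPlus cs z)) (lastPlus xs y)
      ↭⟨ map-concatMap⁺ (node x0) (λ cs → lastPlus cs z) (lastPlus xs) (lastPlus xs y) (y ⊕ z)
           (lastPlus-assoc xs y z) ⟩
    concatMap (λ u → map (node x0) (lastPlus xs u)) (y ⊕ z) ∎

  ⊣-⊥ : ∀ x y z → concatMap (_⊥ z) (x ⊣ y) ↭ concatMap (x ⊥_) (y ⊢ z)
  ⊣-⊥ x y leaf = ↭-reflexive (right-zero (x ⊣ y))
  ⊣-⊥ leaf y (node z0 zs) = ↭-reflexive (sym (concatMap-[] ⊥-zeroˡ (y ⊢ node z0 zs)))
  ⊣-⊥ (node x0 xs) y (node z0 zs) = begin
    concatMap (_⊥ node z0 zs) (map (node x0) (lastPlus xs y))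
      ≡⟨ concatMap-map (_⊥ node z0 zs) (node x0) (lastPlus xs y) ⟩
    concatMap (λ cs → map (node x0) (lastPlusApp cs z0 zs)) (lastPlus xs y)
      ↭⟨ map-concatMap⁺ (node x0) (λ cs → lastPlusApp cs z0 zs) (λ t → lastPlusApp xs t zs)
           (lastPlus xs y) (y ⊕ z0) (lastPlus-lastPlusApp xs y z0 zs) ⟩
    concatMap (λ t → map (node x0) (lastPlusApp xs t zs)) (y ⊕ z0)
      ≡⟨ concatMap-map (node x0 xs ⊥_) (λ t → node t zs) (y ⊕ z0) ⟨
    concatMap (node x0 xs ⊥_) (map (λ t → node t zs) (y ⊕ z0)) ∎

  ⊕-⊢ : ∀ x y z → concatMap (_⊢ z) (x ⊕ y) ↭ concatMap (x ⊢_) (y ⊢ z)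
  ⊕-⊢ x y leaf = ↭-reflexive (right-zero (x ⊕ y))
  ⊕-⊢ x y (node z0 zs) = begin
    concatMap (λ t → map (λ u → node u zs) (t ⊕ z0)) (x ⊕ y)
      ↭⟨ map-concatMap⁺ (λ u → node u zs) (_⊕ z0) (x ⊕_) (x ⊕ y) (y ⊕ z0) (⊕-assoc x y z0) ⟩
    concatMap (λ t → map (λ u → node u zs) (x ⊕ t)) (y ⊕ z0)
      ≡⟨ concatMap-map (x ⊢_) (λ t → node t zs) (y ⊕ z0) ⟨
    concatMap (x ⊢_) (map (λ t → node t zs) (y ⊕ z0)) ∎

open BilinearExtension _⊕_ using (⋆-assoc; ⋆-identityˡ; ⋆-identityʳ)

proposition9p4 : (n m p : ℕ) (X Y Z : List Tree) →
    IsGrove n X → IsGrove m Y → IsGrove p Z →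
    (((X +ᴳ Y) +ᴳ Z) ↭ (X +ᴳ (Y +ᴳ Z)))
      × (([ leaf ] +ᴳ X) ↭ X) × ((X +ᴳ [ leaf ]) ↭ X)
proposition9p4 _ _ _ X Y Z _ _ _ =
    ⋆-assoc ⊕-assoc X Y Z
  , ↭-reflexive (⋆-identityˡ leaf (λ _ → refl) X)
  , ↭-reflexive (⋆-identityʳ leaf ⊕-identityʳ X)
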